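{- Let $n\ge 2$ and let $\mathbf{r}=(r_1,\dots,r_n)$ be a primitive positive integer vector (the gcd of its entries is $1$). Then $\mathbf{r}$ is an arithmetical $r$-structure on the path $\mathcal{P}_n$ if and only if (a) $r_1=r_n=1$, and (b) $r_i$ divides $r_{i-1}+r_{i+1}$ for all $i$ with $2\le i\le n-1$.
   Context: $\mathcal{P}_n$ is the path graph with vertices $1,\dots,n$ and edges $\{i,i+1\}$, with adjacency matrix $A$. An arithmetical structure on a connected graph $G$ with $n$ vertices and adjacency matrix $A$ is a pair $(\mathbf{d},\mathbf{r})$ of positive integer vectors in $\mathbb{Z}^n$ with $\mathbf{r}$ primitive and $(\operatorname{diag}(\mathbf{d})-A)\mathbf{r}=\mathbf{0}$. Each of $\mathbf{d},\mathbf{r}$ determines the other; $\mathbf{r}$ is then called an arithmetical $r$-structure and $\mathbf{d}$ an arithmetical $d$-structure on $G$. -}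

module Defs where

open import Data.Nat using (ℕ; zero; suc; _+_; _<_)
open import Data.Nat.GCD using (gcd)
open import Data.Fin using (Fin; toℕ)
open import Data.List using (List; foldr; tabulate)
open import Data.Bool using (Bool; true; false; if_then_else_; _∨_)
open import Relation.Nullary.Decidable using (⌊_⌋)
open import Data.Integer as ℤ using (ℤ; +_)
open import Relation.Binary.PropositionalEquality using (_≡_)

-- Integer matrices and vectors, indexed by Fin n (vertex i of the paper is Fin index i-1).
Matrix : ℕ → Set
Matrix n = Fin n → Fin n → ℤ

ZVec : ℕ → Set
ZVec n = Fin n → ℤ

sumℤ : List ℤ → ℤ
sumℤ = foldr ℤ._+_ (+ 0)

_·_ : ∀ {n} → Matrix n → ZVec n → ZVec n
(M · v) i = sumℤ (tabulate λ j → M i j ℤ.* v j)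

adjPath : ∀ {n} → Fin n → Fin n → Bool
adjPath i j = ⌊ suc (toℕ i) Data.Nat.≟ toℕ j ⌋ ∨ ⌊ suc (toℕ j) Data.Nat.≟ toℕ i ⌋

pathAdj : (n : ℕ) → Matrix n
pathAdj n i j = if adjPath i j then + 1 else + 0

diag : ∀ {n} → (Fin n → ℕ) → Matrix n
diag d i j = if ⌊ toℕ i Data.Nat.≟ toℕ j ⌋ then + (d i) else + 0

_−ᴹ_ : ∀ {n} → Matrix n → Matrix n → Matrix n
(M −ᴹ N) i j = M i j ℤ.- N i j

Positive : ∀ {n} → (Fin n → ℕ) → Set
Positive v = ∀ i → 0 < v i

Primitive : ∀ {n} → (Fin n → ℕ) → Set
Primitive {n} r = foldr gcd 0 (tabulate r) ≡ 1

IsArithStructure : ∀ {n} → Matrix n → (Fin n → ℕ) → (Fin n → ℕ) → Set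
IsArithStructure {n} A d r =
  Positive d × Positive r × Primitive r ×
  (∀ i → ((diag d −ᴹ A) · (λ j → + (r j))) i ≡ + 0)
  where open import Data.Product using (_×_)

IsArithRStructure : ∀ {n} → Matrix n → (Fin n → ℕ) → Set
IsArithRStructure {n} A r = Σ (Fin n → ℕ) (λ d → IsArithStructure A d r)
  where open import Data.Product using (Σ)

-- Row i of (diag d − A) r = 0 says d_i r_i = r_{i-1} + r_{i+1} (with r_0 = r_{n+1} = 0),
-- so r is an r-structure exactly when every r_i divides the sum of its neighbours, the
-- quotients then being the d_i. In that case any common divisor of two consecutive
-- entries divides the neighbour r_{i±1} on the far side, hence spreads along the whole
-- path. Since r_1 divides r_0 = 0 and r_n divides r_{n+1} = 0, both end entries divide
-- every entry, and primitivity forces them to be 1. Conversely r_1 = r_n = 1 settles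
-- the divisibility at the two ends, and (b) is exactly the divisibility at the interior.
module Submission where

open import Defs
open import Data.Nat using (ℕ; suc)
open import Data.Nat.Divisibility using (_∣_)
open import Data.Nat using (_+_)
open import Data.Fin using (Fin; zero; suc; fromℕ; inject₁)
open import Data.Product using (_×_)
open import Function.Bundles using (_⇔_)
open import Relation.Binary.PropositionalEquality using (_≡_)

open import Data.Bool using (Bool; true; false; if_then_else_; _∨_; T)
open import Data.Empty using (⊥; ⊥-elim)
open import Data.Fin using (toℕ; fromℕ<)
open import Data.Fin.Properties using (toℕ<n; toℕ-fromℕ; toℕ-fromℕ<; toℕ-inject₁)
open import Data.Fin.Relation.Unary.Top using (view; ‵fromℕ; ‵inj₁)
open import Data.Integer as ℤ using (ℤ; +_)
import Data.Integer.Properties as ℤₚ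
open import Data.Integer.Properties using (pos-+; pos-*; +-injective; i-j≡0⇒i≡j; i≡j⇒i-j≡0)
open import Data.Integer.Tactic.RingSolver using (solve-∀)
open import Data.List using (tabulate; foldr)
open import Data.List.Properties using (tabulate-cong)
open import Data.Nat using (zero; _*_; _≡ᵇ_; _≤_; _<_; z≤n; s≤s; >-nonZero; >-nonZero⁻¹)
open import Data.Nat.Properties using (_≟_; ≤-refl; ≤-trans; n≤1+n; m≤n⇒m≤1+n; +-comm; m≤m+n)
open import Data.Nat.Divisibility
  using (divides; quotient; quotient≢0; ∣-refl; ∣-trans; _∣0; 1∣_; ∣1⇒≡1; ∣m+n∣m⇒∣n)
open import Data.Nat.GCD using (gcd; gcd-greatest)
open import Data.Product using (_,_; proj₁; proj₂)
open import Function using (_∘_)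
open import Function.Bundles using (mk⇔; Equivalence)
open import Function.Construct.Composition using (_⇔-∘_)
open import Relation.Nullary.Decidable using (⌊_⌋; isYes≗does)
open import Relation.Binary.PropositionalEquality using (refl; sym; trans; cong; cong₂; subst; module ≡-Reasoning)

entryAt : ∀ {n} → (Fin n → ℕ) → ℕ → ℕ
entryAt {zero}  r k       = 0
entryAt {suc n} r zero    = r zero
entryAt {suc n} r (suc k) = entryAt (r ∘ suc) k

entryAt-toℕ : ∀ {n} (r : Fin n → ℕ) {i : Fin n} {k} → toℕ i ≡ k → entryAt r k ≡ r i
entryAt-toℕ r {zero}  refl = refl
entryAt-toℕ r {suc i} refl = entryAt-toℕ (r ∘ suc) {i} refl

entryAt-length : ∀ {n} (r : Fin n → ℕ) → entryAt r n ≡ 0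
entryAt-length {zero}  r = refl
entryAt-length {suc n} r = entryAt-length (r ∘ suc)

-- padded r (suc k) is the entry of index k, and padded r 0 = padded r (suc n) = 0.
padded : ∀ {n} → (Fin n → ℕ) → ℕ → ℕ
padded r zero    = 0
padded r (suc k) = entryAt r k

neighbourSum : ∀ {n} → (Fin n → ℕ) → Fin n → ℕ
neighbourSum r i = padded r (toℕ i) + padded r (suc (suc (toℕ i)))

NeighbourDivisible : ∀ {n} → (Fin n → ℕ) → Set
NeighbourDivisible r = ∀ i → r i ∣ neighbourSum r i

[_]_ : Bool → ℤ → ℤ
[ b ] x = if b then x else + 0

⌊≟⌋≡≡ᵇ : ∀ m n → ⌊ m ≟ n ⌋ ≡ (m ≡ᵇ n)
⌊≟⌋≡≡ᵇ m n = isYes≗does (m ≟ n)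

≡ᵇ-sym : ∀ a b → (a ≡ᵇ b) ≡ (b ≡ᵇ a)
≡ᵇ-sym zero    zero    = refl
≡ᵇ-sym zero    (suc b) = refl
≡ᵇ-sym (suc a) zero    = refl
≡ᵇ-sym (suc a) (suc b) = ≡ᵇ-sym a b

suc≡ᵇ-not-both : ∀ a b → T (suc a ≡ᵇ b) → T (suc b ≡ᵇ a) → ⊥
suc≡ᵇ-not-both (suc a) (suc b) p q = suc≡ᵇ-not-both a b p q

sumℤ-zero : ∀ n → sumℤ (tabulate {n = n} (λ _ → + 0)) ≡ + 0
sumℤ-zero zero    = refl
sumℤ-zero (suc n) = cong (ℤ._+_ (+ 0)) (sumℤ-zero n)

sumℤ-tabulate-− : ∀ {n} (f g : Fin n → ℤ) →
  sumℤ (tabulate (λ j → f j ℤ.- g j)) ≡ sumℤ (tabulate f) ℤ.- sumℤ (tabulate g)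
sumℤ-tabulate-− {zero}  f g = refl
sumℤ-tabulate-− {suc n} f g =
  trans (cong (ℤ._+_ (f zero ℤ.- g zero)) (sumℤ-tabulate-− (f ∘ suc) (g ∘ suc)))
        (interchange (f zero) (g zero) _ _)
  where
  interchange : ∀ a b c e → (a ℤ.- b) ℤ.+ (c ℤ.- e) ≡ (a ℤ.+ c) ℤ.- (b ℤ.+ e)
  interchange = solve-∀

sumℤ-select : ∀ {n} (f : Fin n → ℕ) k →
  sumℤ (tabulate (λ j → [ k ≡ᵇ toℕ j ] (+ f j))) ≡ + entryAt f k
sumℤ-select {zero}  f k       = refl
sumℤ-select {suc n} f zero    = trans (cong (ℤ._+_ (+ f zero)) (sumℤ-zero n)) (ℤₚ.+-identityʳ _)
sumℤ-select {suc n} f (suc k) = trans (ℤₚ.+-identityˡ _) (sumℤ-select (f ∘ suc) k)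

sumℤ-select-pred : ∀ {n} (f : Fin n → ℕ) k →
  sumℤ (tabulate (λ j → [ suc (toℕ j) ≡ᵇ k ] (+ f j))) ≡ + padded f k
sumℤ-select-pred {n} f zero    = sumℤ-zero n
sumℤ-select-pred     f (suc k) =
  trans (cong sumℤ (tabulate-cong λ j → cong (λ b → [ b ] (+ f j)) (≡ᵇ-sym (toℕ j) k)))
        (sumℤ-select f k)

[_]-*-pos : ∀ b D R → ([ b ] (+ D)) ℤ.* + R ≡ [ b ] (+ (D * R))
[ true  ]-*-pos D R = sym (pos-* D R)
[ false ]-*-pos D R = refl

[∨]-*-pos : ∀ b c R → (T b → T c → ⊥) → ([ b ∨ c ] (+ 1)) ℤ.* + R ≡ [ b ] (+ R) ℤ.+ [ c ] (+ R)
[∨]-*-pos true  true  R not-both = ⊥-elim (not-both _ _)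
[∨]-*-pos true  false R _        = trans (ℤₚ.*-identityˡ (+ R)) (sym (ℤₚ.+-identityʳ (+ R)))
[∨]-*-pos false true  R _        = trans (ℤₚ.*-identityˡ (+ R)) (sym (ℤₚ.+-identityˡ (+ R)))
[∨]-*-pos false false R _        = refl

laplacianEntry-split : ∀ {n} (d r : Fin n → ℕ) (i j : Fin n) →
  (diag d −ᴹ pathAdj n) i j ℤ.* + r j
    ≡ ([ toℕ i ≡ᵇ toℕ j ] (+ (d i * r j)) ℤ.- [ suc (toℕ i) ≡ᵇ toℕ j ] (+ r j))
        ℤ.- [ suc (toℕ j) ≡ᵇ toℕ i ] (+ r j)
laplacianEntry-split d r i j = begin
  (diag d i j ℤ.- pathAdj _ i j) ℤ.* + r j ≡⟨ cong (ℤ._* + r j) (cong₂ ℤ._-_ diag≡D pathAdj≡A) ⟩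
  (D ℤ.- A) ℤ.* + r j                     ≡⟨ distrib D A (+ r j) ⟩
  D ℤ.* + r j ℤ.- A ℤ.* + r j             ≡⟨ cong₂ ℤ._-_ ([ toℕ i ≡ᵇ toℕ j ]-*-pos (d i) (r j))
                                               ([∨]-*-pos _ _ (r j) (suc≡ᵇ-not-both (toℕ i) (toℕ j))) ⟩
  diagonalTerm ℤ.- (right ℤ.+ left)       ≡⟨ assoc diagonalTerm right left ⟩
  diagonalTerm ℤ.- right ℤ.- left         ∎
  where
  open ≡-Reasoning
  D = [ toℕ i ≡ᵇ toℕ j ] (+ d i)
  A = [ (suc (toℕ i) ≡ᵇ toℕ j) ∨ (suc (toℕ j) ≡ᵇ toℕ i) ] (+ 1)
  diag≡D : diag d i j ≡ D
  diag≡D = cong ([_] (+ d i)) (⌊≟⌋≡≡ᵇ (toℕ i) (toℕ j))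
  pathAdj≡A : pathAdj _ i j ≡ A
  pathAdj≡A = cong ([_] (+ 1)) (cong₂ _∨_ (⌊≟⌋≡≡ᵇ (suc (toℕ i)) (toℕ j)) (⌊≟⌋≡≡ᵇ (suc (toℕ j)) (toℕ i)))
  diagonalTerm = [ toℕ i ≡ᵇ toℕ j ] (+ (d i * r j))
  right = [ suc (toℕ i) ≡ᵇ toℕ j ] (+ r j)
  left = [ suc (toℕ j) ≡ᵇ toℕ i ] (+ r j)
  distrib : ∀ x y z → (x ℤ.- y) ℤ.* z ≡ x ℤ.* z ℤ.- y ℤ.* z
  distrib = solve-∀
  assoc : ∀ x y z → x ℤ.- (y ℤ.+ z) ≡ x ℤ.- y ℤ.- z
  assoc = solve-∀

laplacianRow : ∀ {n} (d r : Fin n → ℕ) (i : Fin n) →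
  ((diag d −ᴹ pathAdj n) · (λ j → + r j)) i ≡ + (d i * r i) ℤ.- + neighbourSum r i
laplacianRow d r i = begin
  sumℤ (tabulate (λ j → (diag d −ᴹ pathAdj _) i j ℤ.* + r j))
    ≡⟨ cong sumℤ (tabulate-cong (laplacianEntry-split d r i)) ⟩
  sumℤ (tabulate (λ j → (diagonal j ℤ.- right j) ℤ.- left j))
    ≡⟨ sumℤ-tabulate-− (λ j → diagonal j ℤ.- right j) left ⟩
  sumℤ (tabulate (λ j → diagonal j ℤ.- right j)) ℤ.- sumℤ (tabulate left)
    ≡⟨ cong (ℤ._- sumℤ (tabulate left)) (sumℤ-tabulate-− diagonal right) ⟩
  sumℤ (tabulate diagonal) ℤ.- sumℤ (tabulate right) ℤ.- sumℤ (tabulate left)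
    ≡⟨ cong₂ ℤ._-_ (cong₂ ℤ._-_ (trans (sumℤ-select (λ j → d i * r j) (toℕ i))
                                       (cong +_ (entryAt-toℕ (λ j → d i * r j) refl)))
                                (sumℤ-select r (suc (toℕ i))))
                   (sumℤ-select-pred r (toℕ i)) ⟩
  + (d i * r i) ℤ.- + R₊ ℤ.- + R₋
    ≡⟨ regroup (+ (d i * r i)) (+ R₊) (+ R₋) ⟩
  + (d i * r i) ℤ.- (+ R₊ ℤ.+ + R₋)
    ≡⟨ cong (ℤ._-_ (+ (d i * r i))) (trans (ℤₚ.+-comm (+ R₊) (+ R₋)) (sym (pos-+ R₋ R₊))) ⟩
  + (d i * r i) ℤ.- + neighbourSum r i ∎
  where
  open ≡-Reasoning
  diagonal = λ j → [ toℕ i ≡ᵇ toℕ j ] (+ (d i * r j))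
  right = λ j → [ suc (toℕ i) ≡ᵇ toℕ j ] (+ r j)
  left = λ j → [ suc (toℕ j) ≡ᵇ toℕ i ] (+ r j)
  R₊ = padded r (suc (suc (toℕ i)))
  R₋ = padded r (toℕ i)
  regroup : ∀ x y z → x ℤ.- y ℤ.- z ≡ x ℤ.- (y ℤ.+ z)
  regroup = solve-∀

rowBalanced⇔ : ∀ {n} (d r : Fin n → ℕ) (i : Fin n) →
  ((diag d −ᴹ pathAdj n) · (λ j → + r j)) i ≡ + 0 ⇔ d i * r i ≡ neighbourSum r i
rowBalanced⇔ d r i = mk⇔
  (λ balanced → +-injective (i-j≡0⇒i≡j _ _ (trans (sym (laplacianRow d r i)) balanced)))
  (λ d*r≡s → trans (laplacianRow d r i) (i≡j⇒i-j≡0 (cong +_ d*r≡s)))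

arithRStructure⇔neighbourDivisible : ∀ {n} {r : Fin n → ℕ} → Positive r → Primitive r →
  (∀ i → 0 < neighbourSum r i) → IsArithRStructure (pathAdj n) r ⇔ NeighbourDivisible r
arithRStructure⇔neighbourDivisible {r = r} r>0 prim s>0 = mk⇔
  (λ (d , _ , _ , _ , balanced) i →
     divides (d i) (sym (Equivalence.to (rowBalanced⇔ d r i) (balanced i))))
  (λ r∣s → let d = λ i → quotient (r∣s i) in
     d , (λ i → quotient>0 (r∣s i) (s>0 i)) , r>0 , prim ,
     λ i → Equivalence.from (rowBalanced⇔ d r i) (sym (_∣_.equality (r∣s i))))
  where
  quotient>0 : ∀ {a b} (a∣b : a ∣ b) → 0 < b → 0 < quotient a∣b
  quotient>0 a∣b b>0 = >-nonZero⁻¹ _ {{quotient≢0 a∣b {{>-nonZero b>0}}}}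

module DivisibilityPropagation {n : ℕ} (R : ℕ → ℕ)
  (step : ∀ {k} → k < n → R (suc k) ∣ R k + R (suc (suc k))) where

  _∣Pair_ : ℕ → ℕ → Set
  c ∣Pair k = c ∣ R k × c ∣ R (suc k)

  ∣Pair-suc : ∀ {c k} → k < n → c ∣Pair k → c ∣Pair suc k
  ∣Pair-suc k<n (c∣Rk , c∣Rk+1) =
    c∣Rk+1 , ∣m+n∣m⇒∣n (∣-trans c∣Rk+1 (step k<n)) c∣Rk

  ∣Pair-pred : ∀ {c k} → k < n → c ∣Pair suc k → c ∣Pair k
  ∣Pair-pred {c} {k} k<n (c∣Rk+1 , c∣Rk+2) =
    ∣m+n∣m⇒∣n (subst (c ∣_) (+-comm (R k) _) (∣-trans c∣Rk+1 (step k<n))) c∣Rk+2 , c∣Rk+1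

  ∣Pair⇒∣Pair₀ : ∀ {c a} → a ≤ n → c ∣Pair a → c ∣Pair 0
  ∣Pair⇒∣Pair₀ {a = zero}  _   c∣Pair0 = c∣Pair0
  ∣Pair⇒∣Pair₀ {a = suc a} a<n c∣Pair = ∣Pair⇒∣Pair₀ (≤-trans (n≤1+n a) a<n) (∣Pair-pred a<n c∣Pair)

  ∣Pair₀⇒∣Pair : ∀ {c k} → k ≤ n → c ∣Pair 0 → c ∣Pair k
  ∣Pair₀⇒∣Pair {k = zero}  _   c∣Pair0 = c∣Pair0
  ∣Pair₀⇒∣Pair {k = suc k} k<n c∣Pair0 = ∣Pair-suc k<n (∣Pair₀⇒∣Pair (≤-trans (n≤1+n k) k<n) c∣Pair0)

  ∣Pair⇒∣ : ∀ {c a} → a ≤ n → c ∣Pair a → ∀ {k} → k ≤ suc n → c ∣ R k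
  ∣Pair⇒∣ a≤n c∣Pair {zero}  _         = proj₁ (∣Pair⇒∣Pair₀ a≤n c∣Pair)
  ∣Pair⇒∣ a≤n c∣Pair {suc k} (s≤s k≤n) = proj₂ (∣Pair₀⇒∣Pair k≤n (∣Pair⇒∣Pair₀ a≤n c∣Pair))

neighbourDivisible⇒step : ∀ {n} {r : Fin n → ℕ} → NeighbourDivisible r →
  ∀ {k} → k < n → padded r (suc k) ∣ padded r k + padded r (suc (suc k))
neighbourDivisible⇒step {r = r} r∣s k<n = atIndex (toℕ-fromℕ< k<n)
  where
  atIndex : ∀ {i k} → toℕ i ≡ k → padded r (suc k) ∣ padded r k + padded r (suc (suc k))
  atIndex {i} refl = subst (_∣ neighbourSum r i) (sym (entryAt-toℕ r refl)) (r∣s i)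

∣consecutive⇒∣entries : ∀ {n} {r : Fin n → ℕ} → NeighbourDivisible r → ∀ {a c} → a ≤ n →
  c ∣ padded r a → c ∣ padded r (suc a) → ∀ i → c ∣ r i
∣consecutive⇒∣entries {r = r} r∣s a≤n c∣Ra c∣Ra+1 i =
  subst (_ ∣_) (entryAt-toℕ r refl) (∣Pair⇒∣ a≤n (c∣Ra , c∣Ra+1) (m≤n⇒m≤1+n (toℕ<n i)))
  where open DivisibilityPropagation (padded r) (neighbourDivisible⇒step r∣s)

∣foldr-gcd : ∀ {n} (f : Fin n → ℕ) {c} → (∀ i → c ∣ f i) → c ∣ foldr gcd 0 (tabulate f)
∣foldr-gcd {zero}  f {c} c∣f = c ∣0
∣foldr-gcd {suc n} f     c∣f = gcd-greatest (c∣f zero) (∣foldr-gcd (f ∘ suc) (c∣f ∘ suc))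

primitive⇒commonDivisor≡1 : ∀ {n} {r : Fin n → ℕ} → Primitive r → ∀ {c} → (∀ i → c ∣ r i) → c ≡ 1
primitive⇒commonDivisor≡1 {r = r} prim c∣r = ∣1⇒≡1 (subst (_ ∣_) prim (∣foldr-gcd r c∣r))

first≡1 : ∀ {n} {r : Fin (suc n) → ℕ} → Primitive r → NeighbourDivisible r → r zero ≡ 1
first≡1 prim r∣s = primitive⇒commonDivisor≡1 prim (∣consecutive⇒∣entries r∣s z≤n (_ ∣0) ∣-refl)

last≡1 : ∀ {n} {r : Fin (suc n) → ℕ} → Primitive r → NeighbourDivisible r → r (fromℕ n) ≡ 1
last≡1 {n} {r} prim r∣s = primitive⇒commonDivisor≡1 prim
  (∣consecutive⇒∣entries r∣s ≤-refl
    (subst (r (fromℕ n) ∣_) (sym (entryAt-toℕ r (toℕ-fromℕ n))) ∣-refl)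
    (subst (r (fromℕ n) ∣_) (sym (entryAt-length r)) (_ ∣0)))

neighbourSum-interior : ∀ {m} (r : Fin (suc (suc m)) → ℕ) (j : Fin m) →
  neighbourSum r (suc (inject₁ j)) ≡ r (inject₁ (inject₁ j)) + r (suc (suc j))
neighbourSum-interior r j = cong₂ _+_
  (entryAt-toℕ r (toℕ-inject₁ (inject₁ j)))
  (entryAt-toℕ r {suc (suc j)} (cong (λ k → suc (suc k)) (sym (toℕ-inject₁ j))))

neighbourSum>0 : ∀ {m} {r : Fin (suc (suc m)) → ℕ} → Positive r → ∀ i → 0 < neighbourSum r i
neighbourSum>0 r>0 zero    = r>0 (suc zero)
neighbourSum>0 {r = r} r>0 (suc i) =
  ≤-trans (subst (0 <_) (sym (entryAt-toℕ r (toℕ-inject₁ i))) (r>0 (inject₁ i))) (m≤m+n _ _)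

endpoints∧interior⇒neighbourDivisible : ∀ {m} {r : Fin (suc (suc m)) → ℕ} →
  r zero ≡ 1 → r (fromℕ (suc m)) ≡ 1 →
  (∀ j → r (suc (inject₁ j)) ∣ r (inject₁ (inject₁ j)) + r (suc (suc j))) → NeighbourDivisible r
endpoints∧interior⇒neighbourDivisible {r = r} r₀≡1 rₙ≡1 interior zero =
  subst (_∣ neighbourSum r zero) (sym r₀≡1) (1∣ _)
endpoints∧interior⇒neighbourDivisible {r = r} r₀≡1 rₙ≡1 interior (suc i) with view i
... | ‵fromℕ          = subst (_∣ neighbourSum r (suc i)) (sym rₙ≡1) (1∣ _)
... | ‵inj₁ {i = j} _ = subst (r (suc (inject₁ j)) ∣_) (sym (neighbourSum-interior r j)) (interior j)

neighbourDivisible⇔endpoints∧interior : ∀ {m} {r : Fin (suc (suc m)) → ℕ} → Primitive r →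
  NeighbourDivisible r
    ⇔ ((r zero ≡ 1 × r (fromℕ (suc m)) ≡ 1)
       × (∀ j → r (suc (inject₁ j)) ∣ r (inject₁ (inject₁ j)) + r (suc (suc j))))
neighbourDivisible⇔endpoints∧interior {r = r} prim = mk⇔
  (λ r∣s → (first≡1 prim r∣s , last≡1 prim r∣s) ,
           λ j → subst (r (suc (inject₁ j)) ∣_) (neighbourSum-interior r j) (r∣s (suc (inject₁ j))))
  (λ ((r₀≡1 , rₙ≡1) , interior) → endpoints∧interior⇒neighbourDivisible r₀≡1 rₙ≡1 interior)

corollary2p2 : (m : ℕ) (r : Fin (suc (suc m)) → ℕ) → Positive r → Primitive r →
    IsArithRStructure (pathAdj (suc (suc m))) r
      ⇔ ((r zero ≡ 1 × r (fromℕ (suc m)) ≡ 1)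
         × (∀ (j : Fin m) → r (suc (inject₁ j)) ∣ r (inject₁ (inject₁ j)) + r (suc (suc j))))
corollary2p2 m r r>0 prim =
  neighbourDivisible⇔endpoints∧interior prim
    ⇔-∘ arithRStructure⇔neighbourDivisible r>0 prim (neighbourSum>0 r>0)
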